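{- A context tree $\mathcal{T}$ over $A$ has perfect memory if and only if both of the following hold: (1) $\mathcal{T}$ is complete; and (2) for every string $u$ for which there exists a string $w$ with $\overline{uw}\in\mathcal{T}^*$, there exists a string $w'$ with $\overline{w'u}\in\mathcal{T}^*$.
   Context: Fix a finite alphabet $A=\{a_1,\dots,a_n\}$. Strings are finite sequences (possibly empty) of letters of $A$; $\overline{uv}$ is concatenation; $v\prec s$ ($v$ is a postfix of $s$) if $s=\overline{wv}$ for some string $w$. A context tree over $A$ is a finite rooted tree whose non-root vertices are labeled by letters of $A$, no two siblings having the same label; a context is the string read along the path from a leaf to the root (leaf's label first, label of the root's child last), and $\mathcal{T}^*$ is the set of contexts. $\mathcal{T}$ is complete if every node is a leaf or has exactly $n$ children. $\mathcal{T}$ has perfect memory if for every $c\in\mathcal{T}^*$ and every $i$ there exists $u\in\mathcal{T}^*$ with $u\prec\overline{ca_i}$. -}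

module Defs where

open import Data.Nat using (ℕ)
open import Data.Fin using (Fin)
open import Data.List using (List; []; _∷_; _++_; _∷ʳ_)
open import Data.Maybe using (Maybe; just; nothing)
open import Data.Product using (∃; _×_; _,_)
open import Data.Sum using (_⊎_)
open import Relation.Binary.PropositionalEquality using (_≡_; _≢_)

Str : ℕ → Set
Str n = List (Fin n)

_≺_ : ∀ {n} → Str n → Str n → Set
v ≺ s = ∃ λ w → s ≡ w ++ v

-- Siblings therefore carry
-- distinct labels automatically; the tree is finite (inductive, finitely branching).
data CTree (n : ℕ) : Set where
  node : (Fin n → Maybe (CTree n)) → CTree n

IsLeaf : ∀ {n} → (Fin n → Maybe (CTree n)) → Set
IsLeaf f = ∀ a → f a ≡ nothing

-- A context is read from the leaf
-- to the root: leaf's label first, label of the root's child last.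
data Ctx {n : ℕ} : CTree n → Str n → Set where
  leaf : ∀ {f} → IsLeaf f → Ctx (node f) []
  step : ∀ {f a t w} → f a ≡ just t → Ctx t w → Ctx (node f) (w ∷ʳ a)

data Complete {n : ℕ} : CTree n → Set where
  complete : ∀ {f} →
    (IsLeaf f ⊎ (∀ a → f a ≢ nothing)) →
    (∀ a t → f a ≡ just t → Complete t) →
    Complete (node f)

PerfectMemory : ∀ {n} → CTree n → Set
PerfectMemory {n} T = ∀ (c : Str n) → Ctx T c → ∀ (a : Fin n) →
  ∃ λ (u : Str n) → Ctx T u × (u ≺ (c ∷ʳ a))

-- Call a string x comparable with T if it is a node of T (a postfix of a
-- context) or has a context as a postfix.  Completeness means exactly that
-- every string is comparable, and perfect memory forces this too, by
-- induction on the string.  Moreover no context is a proper postfix of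
-- another.  If T has perfect memory and u w is a context, either u is a node
-- or some context v is a postfix of u; perfect memory then carries v along w
-- to a context that is a postfix of v w, hence of u w, so u = v.
-- Conversely, for a context c of a complete tree, c a is comparable: either
-- it has a context as a postfix, or it is a node z c a; then z c, a prefix of
-- a context, is a node w′ z c, and since c is a context z must be empty.
module Submission where

open import Defs
open import Data.Nat using (ℕ; zero; suc)
open import Data.Fin using (Fin; zero; suc)
open import Data.List using ([]; _∷_; _++_; _∷ʳ_; [_])
open import Data.List.Properties using (++-assoc; ++-identityʳ; ++-conicalˡ; ++-conicalʳ; ∷ʳ-injective; ∷-injectiveʳ)
open import Data.List.Reverse using (Reverse; []; _∶_∶ʳ_; reverseView)
open import Data.Maybe using (Maybe; just; nothing)
open import Data.Maybe.Properties using (just-injective)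
open import Data.Product using (∃; ∃₂; _×_; _,_; proj₁; uncurry)
open import Data.Sum using (_⊎_; inj₁; inj₂)
open import Data.Empty using (⊥-elim)
open import Function.Base using (case_of_)
open import Function.Bundles using (_⇔_; mk⇔)
open import Relation.Binary.PropositionalEquality using (_≡_; _≢_; refl; sym; trans; cong; subst)

module _ {n : ℕ} where

  ≺-trans : ∀ {u v s : Str n} → u ≺ v → v ≺ s → u ≺ s
  ≺-trans {u} (y , v≡yu) (x , s≡xv) = x ++ y , trans s≡xv (trans (cong (x ++_) v≡yu) (sym (++-assoc x y u)))

  ≺-∷ʳ : ∀ {v s : Str n} a → v ≺ s → (v ∷ʳ a) ≺ (s ∷ʳ a)
  ≺-∷ʳ {v} a (y , refl) = y , ++-assoc y v [ a ]

  ≺-total : ∀ {u v : Str n} (y z : Str n) → y ++ u ≡ z ++ v → u ≺ v ⊎ v ≺ u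
  ≺-total []      z       eq = inj₂ (z , eq)
  ≺-total (x ∷ y) []      eq = inj₁ (x ∷ y , sym eq)
  ≺-total (x ∷ y) (_ ∷ z) eq = ≺-total y z (∷-injectiveʳ eq)

  nothing-or-just : ∀ {m} {A : Set} (h : Fin m → Maybe A) →
                    (∀ i → h i ≡ nothing) ⊎ ∃₂ λ i x → h i ≡ just x
  nothing-or-just {zero}  h = inj₁ λ ()
  nothing-or-just {suc m} h with h zero in e
  ... | just x = inj₂ (zero , x , e)
  ... | nothing with nothing-or-just (λ i → h (suc i))
  ...   | inj₁ none        = inj₁ λ { zero → e ; (suc i) → none i }
  ...   | inj₂ (i , x , e′) = inj₂ (suc i , x , e′)

  ctx-exists : (t : CTree n) → ∃ (Ctx t)
  ctx-exists (node f) with nothing-or-just f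
  ... | inj₁ lf = [] , leaf lf
  ... | inj₂ (a , _ , e₀) with f a in e | e₀
  ...   | just t | _ = let w , c = ctx-exists t in w ∷ʳ a , step e c

  ctx-leaf : ∀ {f} {w : Str n} → IsLeaf f → Ctx (node f) w → w ≡ []
  ctx-leaf lf (leaf _) = refl
  ctx-leaf lf (step {a = a} e _) = case trans (sym (lf a)) e of λ ()

  ctx-∷ʳ⁻¹ : ∀ {f} {w : Str n} {a} → Ctx (node f) (w ∷ʳ a) → ∃ λ t → f a ≡ just t × Ctx t w
  ctx-∷ʳ⁻¹ c = go c refl
    where
    go : ∀ {f} {w v : Str n} {a} → Ctx (node f) v → v ≡ w ∷ʳ a → ∃ λ t → f a ≡ just t × Ctx t w
    go {w = w} {a = a} (leaf _) eq with ++-conicalʳ w [ a ] (sym eq)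
    ... | ()
    go {w = w} (step {w = w′} e c) eq with ∷ʳ-injective w′ w eq
    ... | refl , refl = _ , e , c

  ctx-postfix-free : ∀ {t} {s l : Str n} → Ctx t s → Ctx t l → (s≺l : s ≺ l) → proj₁ s≺l ≡ []
  ctx-postfix-free (leaf lf) c (y , refl) = ++-conicalˡ y [] (ctx-leaf lf c)
  ctx-postfix-free (step {a = a} {w = w} e c) c′ (y , refl)
    with ctx-∷ʳ⁻¹ (subst (Ctx _) (sym (++-assoc y w [ a ])) c′)
  ... | _ , e′ , c″ with just-injective (trans (sym e) e′)
  ... | refl = ctx-postfix-free c c″ (y , refl)

  -- Read from right to left, a node of T spells the path from the root to a vertex.
  Node : CTree n → Str n → Set
  Node T x = ∃ λ z → Ctx T (z ++ x)

  HasContext : CTree n → Str n → Set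
  HasContext T s = ∃ λ v → Ctx T v × v ≺ s

  Comparable : CTree n → Str n → Set
  Comparable T x = Node T x ⊎ HasContext T x

  PrefixesAreNodes : CTree n → Set
  PrefixesAreNodes T = ∀ u → (∃ λ w → Ctx T (u ++ w)) → Node T u

  root-node : (T : CTree n) → Node T []
  root-node T = let w , c = ctx-exists T in w , subst (Ctx T) (sym (++-identityʳ w)) c

  comparable-child : ∀ {f a t} {x : Str n} → f a ≡ just t →
                     Comparable t x → Comparable (node f) (x ∷ʳ a)
  comparable-child {a = a} {x = x} e (inj₁ (z , c)) =
    inj₁ (z , subst (Ctx _) (++-assoc z x [ a ]) (step e c))
  comparable-child {a = a} e (inj₂ (v , c , v≺x)) = inj₂ (v ∷ʳ a , step e c , ≺-∷ʳ a v≺x)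

  comparable-∷ʳ⁻¹ : ∀ {f a} {x : Str n} → Comparable (node f) (x ∷ʳ a) →
                       IsLeaf f ⊎ ∃ λ t → f a ≡ just t × Comparable t x
  comparable-∷ʳ⁻¹ {a = a} {x} (inj₁ (z , c))
    with ctx-∷ʳ⁻¹ (subst (Ctx _) (sym (++-assoc z x [ a ])) c)
  ... | t , e , c′ = inj₂ (t , e , inj₁ (z , c′))
  comparable-∷ʳ⁻¹ (inj₂ (_ , leaf lf , _)) = inj₁ lf
  comparable-∷ʳ⁻¹ {x = x} (inj₂ (_ , step {a = b} {w = w} e c , y , eq))
    with ∷ʳ-injective x (y ++ w) (trans eq (sym (++-assoc y w [ b ])))
  ... | x≡yw , refl = inj₂ (_ , e , inj₂ (w , c , y , x≡yw))

  comparable-child⁻¹ : ∀ {f a t} {x : Str n} → f a ≡ just t →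
                        Comparable (node f) (x ∷ʳ a) → Comparable t x
  comparable-child⁻¹ {a = a} e cmp with comparable-∷ʳ⁻¹ cmp
  ... | inj₁ lf = case trans (sym e) (lf a) of λ ()
  ... | inj₂ (_ , e′ , cmp′) with just-injective (trans (sym e) e′)
  ... | refl = cmp′

  complete⇒comparable : ∀ {T} → Complete T → ∀ x → Comparable T x
  complete⇒comparable {T} cT x = go (reverseView x) T cT
    where
    go : ∀ {x} → Reverse x → ∀ T → Complete T → Comparable T x
    go [] T _ = inj₁ (root-node T)
    go (x ∶ _ ∶ʳ a) (node f) (complete (inj₁ lf) _) =
      inj₂ ([] , leaf lf , x ∷ʳ a , sym (++-identityʳ (x ∷ʳ a)))
    go (x ∶ rx ∶ʳ a) (node f) (complete (inj₂ full) children) with f a in e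
    ... | nothing = ⊥-elim (full a e)
    ... | just t  = comparable-child e (go rx t (children a t e))

  comparable⇒complete : ∀ {T} → (∀ x → Comparable T x) → Complete T
  comparable⇒complete {node f} cmp = complete leaf-or-full children
    where
    leaf-or-full : IsLeaf f ⊎ (∀ a → f a ≢ nothing)
    leaf-or-full with nothing-or-just f
    ... | inj₁ lf = inj₁ lf
    ... | inj₂ (a , _ , e) = inj₂ λ b fb≡nothing → case comparable-∷ʳ⁻¹ {x = []} (cmp [ b ]) of λ
      { (inj₁ lf) → case trans (sym e) (lf a) of λ ()
      ; (inj₂ (_ , fb≡just , _)) → case trans (sym fb≡just) fb≡nothing of λ () }

    children : ∀ a t → f a ≡ just t → Complete t
    children a t e with f a in e′
    ... | just t′ with just-injective e
    ... | refl = comparable⇒complete λ x → comparable-child⁻¹ e′ (cmp (x ∷ʳ a))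

  module _ {T : CTree n} (pm : PerfectMemory T) where

    hasContext-∷ʳ : ∀ {s} a → HasContext T s → HasContext T (s ∷ʳ a)
    hasContext-∷ʳ a (v , c , v≺s) =
      let u , c′ , u≺va = pm v c a in u , c′ , ≺-trans u≺va (≺-∷ʳ a v≺s)

    hasContext-++ : ∀ {s} w → HasContext T s → HasContext T (s ++ w)
    hasContext-++ {s} []      h = subst (HasContext T) (sym (++-identityʳ s)) h
    hasContext-++ {s} (a ∷ w) h =
      subst (HasContext T) (++-assoc s [ a ] w) (hasContext-++ w (hasContext-∷ʳ a h))

    perfectMemory⇒comparable : ∀ x → Comparable T x
    perfectMemory⇒comparable x = go (reverseView x)
      where
      go : ∀ {x} → Reverse x → Comparable T x
      go [] = inj₁ (root-node T)
      go (x ∶ rx ∶ʳ a) with go rx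
      ... | inj₂ h = inj₂ (hasContext-∷ʳ a h)
      ... | inj₁ (z , c) with pm (z ++ x) c a
      ...   | u , c′ , y , eq with ≺-total y z (trans (sym eq) (++-assoc z x [ a ]))
      ...     | inj₁ u≺xa        = inj₂ (u , c′ , u≺xa)
      ...     | inj₂ (z′ , refl) = inj₁ (z′ , c′)

    perfectMemory⇒prefixesAreNodes : PrefixesAreNodes T
    perfectMemory⇒prefixesAreNodes u (w , c) with perfectMemory⇒comparable u
    ... | inj₁ u-node = u-node
    ... | inj₂ (v , cv , t , refl) with hasContext-++ w (v , cv , [] , refl)
    ...   | s , cs , y , vw≡ys
      with ++-conicalˡ t y (ctx-postfix-free cs c (≺-trans (y , vw≡ys) (t , ++-assoc t v w)))
    ...     | refl = [] , cv

  complete⇒perfectMemory : ∀ {T} → Complete T → PrefixesAreNodes T → PerfectMemory T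
  complete⇒perfectMemory {T} cT nodes c cc a with complete⇒comparable cT (c ∷ʳ a)
  ... | inj₂ h = h
  ... | inj₁ (z , c′) with nodes (z ++ c) ([ a ] , subst (Ctx T) (sym (++-assoc z c [ a ])) c′)
  ...   | w′ , c″ with ++-conicalʳ w′ z (ctx-postfix-free cc c″ (w′ ++ z , sym (++-assoc w′ z c)))
  ...     | refl = c ∷ʳ a , c′ , [] , refl

corollary2 : ∀ {n : ℕ} (T : CTree n) →
    PerfectMemory T ⇔
      (Complete T ×
       (∀ (u : Str n) → (∃ λ (w : Str n) → Ctx T (u ++ w)) →
          ∃ λ (w′ : Str n) → Ctx T (w′ ++ u)))
corollary2 T = mk⇔
  (λ pm → comparable⇒complete (perfectMemory⇒comparable pm) , perfectMemory⇒prefixesAreNodes pm)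
  (uncurry complete⇒perfectMemory)
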